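{- Let $G$ be a simple finite graph with $n$ vertices, $m$ edges and no isolated vertices, and let $S(G)$ be its subdivision. Then, as an identity of rational functions in $\lambda$, $$\phi_{\mathbf R}(S(G),\lambda)=\frac{\lambda^{m-n}}{2^n}\,\phi_{\mathcal Q}(G,2\lambda^2),$$ where $\phi_{\mathbf R}(S(G),\lambda)=\det(\lambda I-\mathbf R(S(G)))$ and $\phi_{\mathcal Q}(G,\lambda)=\det(\lambda I-\mathcal Q(G))$.
   Context: All graphs are simple, undirected, finite, and have no isolated vertices. For a graph $H$ with vertices $v_1,\dots,v_N$ of degrees $d_1,\dots,d_N$, the Randić matrix $\mathbf R(H)=(r_{ij})$ is the $N\times N$ matrix with $r_{ij}=1/\sqrt{d_id_j}$ if $v_i$ and $v_j$ are adjacent and $r_{ij}=0$ otherwise (in particular $r_{ii}=0$); equivalently $\mathbf R(H)=D^{ -1/2}AD^{ -1/2}$ with $A$ the adjacency matrix and $D$ the diagonal degree matrix. The normalized signless Laplacian matrix is $\mathcal Q(H)=I+\mathbf R(H)=D^{ -1/2}(D+A)D^{ -1/2}$. For a matrix $M(H)$, $\phi_M(H,\lambda)=\det(\lambda I-M(H))$. The subdivision $S(G)$ of $G$ is the graph obtained from $G$ by inserting one new vertex (of degree $2$) into each edge of $G$. -}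

module Defs where

open import Level using (Level)
open import Algebra.Bundles using (CommutativeRing)
open import Data.Nat using (ℕ; zero; suc; _≤_) renaming (_+_ to _+ℕ_)
open import Data.Fin using (Fin; zero; suc; toℕ; punchIn; splitAt)
open import Data.Fin.Properties using (_≟_)
open import Data.Bool using (Bool; true; false; if_then_else_; _∨_; _∧_)
open import Data.Product using (_×_; _,_; proj₁; proj₂)
open import Data.Sum using (_⊎_; inj₁; inj₂)
open import Relation.Binary.PropositionalEquality using (_≡_; _≢_)
open import Relation.Nullary.Decidable using (⌊_⌋)

anyFin : ∀ {k} → (Fin k → Bool) → Bool
anyFin {zero}  p = false
anyFin {suc k} p = p zero ∨ anyFin (λ i → p (suc i))

countFin : ∀ {k} → (Fin k → Bool) → ℕ
countFin {zero}  p = 0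
countFin {suc k} p = (if p zero then 1 else 0) +ℕ countFin (λ i → p (suc i))

AdjFn : ℕ → Set
AdjFn N = Fin N → Fin N → Bool

degree : ∀ {N} → AdjFn N → Fin N → ℕ
degree adj i = countFin (adj i)

EdgeList : ℕ → ℕ → Set
EdgeList n m = Fin m → Fin n × Fin n

SameEdge : ∀ {n} → Fin n × Fin n → Fin n × Fin n → Set
SameEdge (a , b) (c , d) = (a ≡ c × b ≡ d) ⊎ (a ≡ d × b ≡ c)

-- simple: no loops and no multiple edges (so m is exactly the number of edges)
Simple : ∀ {n m} → EdgeList n m → Set
Simple {n} {m} E =
  ((e : Fin m) → proj₁ (E e) ≢ proj₂ (E e)) ×
  ((e f : Fin m) → SameEdge (E e) (E f) → e ≡ f)

incident : ∀ {n} → Fin n → Fin n × Fin n → Bool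
incident v (a , b) = ⌊ v ≟ a ⌋ ∨ ⌊ v ≟ b ⌋

adjG : ∀ {n m} → EdgeList n m → AdjFn n
adjG E i j = anyFin (λ e → (⌊ i ≟ proj₁ (E e) ⌋ ∧ ⌊ j ≟ proj₂ (E e) ⌋)
                         ∨ (⌊ j ≟ proj₁ (E e) ⌋ ∧ ⌊ i ≟ proj₂ (E e) ⌋))

NoIsolated : ∀ {n m} → EdgeList n m → Set
NoIsolated {n} E = (v : Fin n) → 1 ≤ degree (adjG E) v

-- Subdivision S(G): vertex set Fin (n +ℕ m); the first n are the old
-- vertices, vertex n + e is the new vertex inserted into edge e.
adjS : ∀ {n m} → EdgeList n m → AdjFn (n +ℕ m)
adjS {n} E x y with splitAt n x | splitAt n y
... | inj₁ v | inj₂ e = incident v (E e)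
... | inj₂ e | inj₁ v = incident v (E e)
... | _      | _      = false

module Matrices {c ℓ : Level} (K : CommutativeRing c ℓ) where
  open CommutativeRing K using (Carrier; _≈_; _+_; _*_; -_; _-_; 0#; 1#)

  Mat : ℕ → Set c
  Mat N = Fin N → Fin N → Carrier

  sumFin : ∀ {k} → (Fin k → Carrier) → Carrier
  sumFin {zero}  f = 0#
  sumFin {suc k} f = f zero + sumFin (λ i → f (suc i))

  pow : Carrier → ℕ → Carrier
  pow x zero    = 1#
  pow x (suc k) = x * pow x k

  natK : ℕ → Carrier
  natK zero    = 0#
  natK (suc k) = 1# + natK k

  det : ∀ {N} → Mat N → Carrier
  det {zero}  M = 1#
  det {suc N} M =
    sumFin (λ j → pow (- 1#) (toℕ j) * M zero j
                   * det (λ r s → M (suc r) (punchIn j s)))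

  idM : ∀ {N} → Mat N
  idM i j = if ⌊ i ≟ j ⌋ then 1# else 0#

  charPoly : ∀ {N} → Mat N → Carrier → Carrier
  charPoly M x = det (λ i j → x * idM i j - M i j)

  -- Randić matrix, given a choice isq k of 1/√k:
  -- r_ij = (1/√d_i)(1/√d_j) if i ~ j, and 0 otherwise.
  randic : (isq : ℕ → Carrier) → ∀ {N} → AdjFn N → Mat N
  randic isq adj i j =
    if adj i j then isq (degree adj i) * isq (degree adj j) else 0#

  nsLap : (isq : ℕ → Carrier) → ∀ {N} → AdjFn N → Mat N
  nsLap isq adj i j = idM i j + randic isq adj i j

  IsInvSqrt : (ℕ → Carrier) → Set ℓ
  IsInvSqrt isq = ∀ k → isq (suc k) * isq (suc k) * natK (suc k) ≈ 1#

module Submission where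

-- Order the vertices of S(G) as the n old vertices followed by the m subdivision vertices.
-- S(G) is bipartite, old vertices keep their degree d_v and new ones have degree 2, so
--   λI − R(S(G)) = [[λI, −B], [−Bᵀ, λI]]   with   B_ve = [v ∈ e] / √(2 d_v).
-- Clearing the upper-right block by row operations (the Schur complement) gives
--   λⁿ φ_R(S(G), λ) = λᵐ det(λ² I − B Bᵀ),
-- and 2 (B Bᵀ)_vw = Σ_e [v, w ∈ e] / √(d_v d_w) is 1 for v = w and r_vw otherwise, i.e.
-- 2 B Bᵀ = Q(G).  Hence 2ⁿ λⁿ φ_R(S(G), λ) = λᵐ det(2λ² I − Q(G)) = λᵐ φ_Q(G, 2λ²).

open import Defs
open import Level using (Level; _⊔_)
open import Algebra.Bundles using (CommutativeRing)
import Algebra.Properties.Ring as RingProperties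
import Algebra.Properties.Semiring.Mult.TCOptimised as SemiringMult
import Algebra.Solver.CommutativeMonoid as CommutativeMonoidSolver
import Algebra.Solver.Ring.AlmostCommutativeRing as ACR
open import Data.Bool using (Bool; true; false; if_then_else_; _∧_; _∨_)
open import Data.Bool.Properties using (∧-zeroʳ; ∧-identityʳ; ∨-identityʳ; ∧-idem)
open import Data.Empty using (⊥-elim)
open import Data.Fin as Fin using (Fin; zero; suc; toℕ; punchIn; _↑ˡ_; _↑ʳ_; splitAt)
open import Data.Fin.Properties
  using (_≟_; suc-injective; toℕ-↑ˡ; splitAt-↑ˡ; splitAt-↑ʳ; ↑ˡ-injective; ↑ʳ-injective)
open import Data.Integer as ℤ using (ℤ; +_; -[1+_]; _⊖_)
import Data.Integer.Properties as ℤ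
open import Data.Maybe using (Maybe; just; nothing)
open import Data.Nat as ℕ using (ℕ; zero; suc)
import Data.Nat.Properties as ℕ
open import Data.Product using (_,_; proj₁; proj₂)
open import Data.Sum using (inj₁; inj₂)
open import Data.Vec.Functional using (_++_)
open import Data.Vec.Functional.Properties using (lookup-++ˡ; lookup-++ʳ)
open import Function using (_∘_)
open import Relation.Binary.PropositionalEquality as ≡ using (_≡_; _≢_)
open import Relation.Nullary using (Dec; yes; no)
open import Relation.Nullary.Decidable using (⌊_⌋)

-- Ring normalisation needs coefficients that compute, so ℤ is mapped into K by
-- n ↦ n × 1#; the optimised _×_ makes ⟦ ± 1 ⟧ℤ reduce to ± 1# on the nose.
module RingSolver {c ℓ : Level} (K : CommutativeRing c ℓ) where
  open CommutativeRing K
  open RingProperties ring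
  open SemiringMult semiring using (_×_; 1+×; ×-homo-+; ×1-homo-*)
  open import Relation.Binary.Reasoning.Setoid setoid

  ⟦_⟧ℤ : ℤ → Carrier
  ⟦ + n ⟧ℤ      = n × 1#
  ⟦ -[1+ n ] ⟧ℤ = - (suc n × 1#)

  ⟦-⟧ℤ : ∀ i → ⟦ ℤ.- i ⟧ℤ ≈ - ⟦ i ⟧ℤ
  ⟦-⟧ℤ -[1+ n ]  = sym (-‿involutive _)
  ⟦-⟧ℤ (+ zero)  = sym -0#≈0#
  ⟦-⟧ℤ (+ suc n) = refl

  ⟦⊖⟧ℤ : ∀ m n → ⟦ m ⊖ n ⟧ℤ ≈ m × 1# - n × 1#
  ⟦⊖⟧ℤ m       zero    = sym (trans (+-congˡ -0#≈0#) (+-identityʳ _))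
  ⟦⊖⟧ℤ zero    (suc n) = sym (+-identityˡ _)
  ⟦⊖⟧ℤ (suc m) (suc n) = begin
    ⟦ suc m ⊖ suc n ⟧ℤ               ≡⟨ ≡.cong ⟦_⟧ℤ (ℤ.[1+m]⊖[1+n]≡m⊖n m n) ⟩
    ⟦ m ⊖ n ⟧ℤ                       ≈⟨ ⟦⊖⟧ℤ m n ⟩
    a - b                            ≈⟨ +-identityˡ _ ⟨
    0# + (a - b)                     ≈⟨ +-congʳ (-‿inverseʳ 1#) ⟨
    (1# - 1#) + (a - b)              ≈⟨ shuffle 1# a (- 1#) (- b) ⟩
    (1# + a) + (- 1# + - b)          ≈⟨ +-congˡ (-‿+-comm 1# b) ⟩
    (1# + a) - (1# + b)              ≈⟨ +-cong (1+× m 1#) (-‿cong (1+× n 1#)) ⟨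
    suc m × 1# - suc n × 1#          ∎
    where
    a b : Carrier
    a = m × 1#
    b = n × 1#
    open CommutativeMonoidSolver +-commutativeMonoid
    shuffle : ∀ w x y z → (w + y) + (x + z) ≈ (w + x) + (y + z)
    shuffle = solve 4 (λ w x y z → (w ⊕ y) ⊕ (x ⊕ z) ⊜ (w ⊕ x) ⊕ (y ⊕ z)) refl

  ⟦+⟧ℤ : ∀ i j → ⟦ i ℤ.+ j ⟧ℤ ≈ ⟦ i ⟧ℤ + ⟦ j ⟧ℤ
  ⟦+⟧ℤ (+ m)    (+ n)    = ×-homo-+ 1# m n
  ⟦+⟧ℤ (+ m)    -[1+ n ] = ⟦⊖⟧ℤ m (suc n)
  ⟦+⟧ℤ -[1+ m ] (+ n)    = trans (⟦⊖⟧ℤ n (suc m)) (+-comm _ _)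
  ⟦+⟧ℤ -[1+ m ] -[1+ n ] = begin
    - (suc (suc (m ℕ.+ n)) × 1#)     ≡⟨ ≡.cong (λ k → - (suc k × 1#)) (ℕ.+-suc m n) ⟨
    - ((suc m ℕ.+ suc n) × 1#)       ≈⟨ -‿cong (×-homo-+ 1# (suc m) (suc n)) ⟩
    - (suc m × 1# + suc n × 1#)      ≈⟨ -‿+-comm _ _ ⟨
    - (suc m × 1#) + - (suc n × 1#)  ∎

  ⟦+*⟧ℤ : ∀ m j → ⟦ + m ℤ.* j ⟧ℤ ≈ m × 1# * ⟦ j ⟧ℤ
  ⟦+*⟧ℤ m (+ n) = begin
    ⟦ + m ℤ.* + n ⟧ℤ         ≡⟨ ≡.cong ⟦_⟧ℤ (ℤ.pos-* m n) ⟨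
    (m ℕ.* n) × 1#           ≈⟨ ×1-homo-* m n ⟩
    m × 1# * n × 1#          ∎
  ⟦+*⟧ℤ m -[1+ n ] = begin
    ⟦ + m ℤ.* ℤ.- (+ suc n) ⟧ℤ  ≡⟨ ≡.cong ⟦_⟧ℤ (ℤ.neg-distribʳ-* (+ m) (+ suc n)) ⟨
    ⟦ ℤ.- (+ m ℤ.* + suc n) ⟧ℤ  ≈⟨ ⟦-⟧ℤ (+ m ℤ.* + suc n) ⟩
    - ⟦ + m ℤ.* + suc n ⟧ℤ      ≈⟨ -‿cong (⟦+*⟧ℤ m (+ suc n)) ⟩
    - (m × 1# * suc n × 1#)     ≈⟨ -‿distribʳ-* _ _ ⟩
    m × 1# * - (suc n × 1#)     ∎

  ⟦*⟧ℤ : ∀ i j → ⟦ i ℤ.* j ⟧ℤ ≈ ⟦ i ⟧ℤ * ⟦ j ⟧ℤ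
  ⟦*⟧ℤ (+ m)    j = ⟦+*⟧ℤ m j
  ⟦*⟧ℤ -[1+ m ] j = begin
    ⟦ ℤ.- (+ suc m) ℤ.* j ⟧ℤ    ≡⟨ ≡.cong ⟦_⟧ℤ (ℤ.neg-distribˡ-* (+ suc m) j) ⟨
    ⟦ ℤ.- (+ suc m ℤ.* j) ⟧ℤ    ≈⟨ ⟦-⟧ℤ (+ suc m ℤ.* j) ⟩
    - ⟦ + suc m ℤ.* j ⟧ℤ        ≈⟨ -‿cong (⟦+*⟧ℤ (suc m) j) ⟩
    - (suc m × 1# * ⟦ j ⟧ℤ)     ≈⟨ -‿distribˡ-* _ _ ⟩
    - (suc m × 1#) * ⟦ j ⟧ℤ     ∎

  private
    almostCommutativeRing : ACR.AlmostCommutativeRing c ℓ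
    almostCommutativeRing = ACR.fromCommutativeRing K

    ℤ⟶K : ℤ.+-*-rawRing ACR.-Raw-AlmostCommutative⟶ almostCommutativeRing
    ℤ⟶K = record
      { ⟦_⟧ = ⟦_⟧ℤ ; +-homo = ⟦+⟧ℤ ; *-homo = ⟦*⟧ℤ ; -‿homo = ⟦-⟧ℤ
      ; 0-homo = refl ; 1-homo = refl }

    ⟦⟧ℤ-≟ : ∀ i j → Maybe (⟦ i ⟧ℤ ≈ ⟦ j ⟧ℤ)
    ⟦⟧ℤ-≟ i j with i ℤ.≟ j
    ... | yes ≡.refl = just refl
    ... | no _       = nothing

  open import Algebra.Solver.Ring ℤ.+-*-rawRing almostCommutativeRing ℤ⟶K ⟦⟧ℤ-≟ public

module Counting where
  open import Algebra.Properties.CommutativeMonoid.Sum ℕ.+-0-commutativeMonoid public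
    using (sum; ∑-comm; ∑-distrib-+; sum-cong-≗; sum-replicate-zero)

  fromBool : Bool → ℕ
  fromBool b = if b then 1 else 0

  countFin-sum : ∀ {k} (p : Fin k → Bool) → countFin p ≡ sum (fromBool ∘ p)
  countFin-sum {zero}  p = ≡.refl
  countFin-sum {suc k} p = ≡.cong (fromBool (p zero) ℕ.+_) (countFin-sum (p ∘ suc))

  sum-zero : ∀ {k} {f : Fin k → ℕ} → (∀ i → f i ≡ 0) → sum f ≡ 0
  sum-zero {k} eq = ≡.trans (sum-cong-≗ eq) (sum-replicate-zero k)

  sum-↑ : ∀ a b (f : Fin (a ℕ.+ b) → ℕ) → sum f ≡ sum (λ i → f (i ↑ˡ b)) ℕ.+ sum (λ k → f (a ↑ʳ k))
  sum-↑ zero    b f = ≡.refl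
  sum-↑ (suc a) b f = ≡.trans (≡.cong (f zero ℕ.+_) (sum-↑ a b (f ∘ suc)))
                              (≡.sym (ℕ.+-assoc (f zero) _ _))

  count-≟ : ∀ {k} (a : Fin k) → sum (λ y → fromBool ⌊ y ≟ a ⌋) ≡ 1
  count-≟ {suc k} zero    = ≡.cong suc (sum-zero {k} λ _ → ≡.refl)
  count-≟ {suc k} (suc a) = ≡.trans (sum-cong-≗ suc≟suc) (count-≟ a)
    where
    suc≟suc : ∀ y → fromBool ⌊ suc y ≟ suc a ⌋ ≡ fromBool ⌊ y ≟ a ⌋
    suc≟suc y with y ≟ a
    ... | yes _ = ≡.refl
    ... | no _  = ≡.refl

  count-atMostOne : ∀ {k} (p : Fin k → Bool) → (∀ {e f} → p e ≡ true → p f ≡ true → e ≡ f) →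
    sum (fromBool ∘ p) ≡ fromBool (anyFin p)
  count-atMostOne {zero}  p unique = ≡.refl
  count-atMostOne {suc k} p unique with p zero in p₀
  ... | true  = ≡.cong suc (sum-zero others)
    where
    others : ∀ i → fromBool (p (suc i)) ≡ 0
    others i with p (suc i) in pᵢ
    ... | true with () ← unique p₀ pᵢ
    ... | false = ≡.refl
  ... | false = count-atMostOne (p ∘ suc) λ pe pf → suc-injective (unique pe pf)

  anyFin-false : ∀ {k} (p : Fin k → Bool) → (∀ i → p i ≡ false) → anyFin p ≡ false
  anyFin-false {zero}  p none = ≡.refl
  anyFin-false {suc k} p none rewrite none zero = anyFin-false (p ∘ suc) (none ∘ suc)

punchIn-↑ˡ : ∀ {n} m (j : Fin (suc n)) (i : Fin n) → punchIn (j ↑ˡ m) (i ↑ˡ m) ≡ punchIn j i ↑ˡ m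
punchIn-↑ˡ m zero    i       = ≡.refl
punchIn-↑ˡ m (suc j) zero    = ≡.refl
punchIn-↑ˡ m (suc j) (suc i) = ≡.cong suc (punchIn-↑ˡ m j i)

punchIn-↑ʳ : ∀ {n m} (j : Fin (suc n)) (k : Fin m) → punchIn (j ↑ˡ m) (n ↑ʳ k) ≡ suc n ↑ʳ k
punchIn-↑ʳ         zero    k = ≡.refl
punchIn-↑ʳ {suc n} (suc j) k = ≡.cong suc (punchIn-↑ʳ j k)

↑ˡ≢↑ʳ : ∀ {n m} (v : Fin n) (e : Fin m) → v ↑ˡ m ≢ n ↑ʳ e
↑ˡ≢↑ʳ {n} {m} v e eq
  with () ← ≡.trans (≡.sym (splitAt-↑ˡ n v m)) (≡.trans (≡.cong (splitAt n) eq) (splitAt-↑ʳ n m e))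

module FinSums {c ℓ : Level} (K : CommutativeRing c ℓ) where
  open CommutativeRing K hiding (zero)
  open Matrices K
  open RingSolver K
  open Counting using (sum; fromBool)
  open RingProperties ring using (-0#≈0#; -‿+-comm)

  sumFin-cong : ∀ {k} {f g : Fin k → Carrier} → (∀ i → f i ≈ g i) → sumFin f ≈ sumFin g
  sumFin-cong {zero}  eq = refl
  sumFin-cong {suc k} eq = +-cong (eq zero) (sumFin-cong (eq ∘ suc))

  sumFin-zero : ∀ {k} {f : Fin k → Carrier} → (∀ i → f i ≈ 0#) → sumFin f ≈ 0#
  sumFin-zero {zero}  eq = refl
  sumFin-zero {suc k} eq = trans (+-cong (eq zero) (sumFin-zero (eq ∘ suc))) (+-identityʳ 0#)

  sumFin-+ : ∀ {k} (f g : Fin k → Carrier) → sumFin (λ i → f i + g i) ≈ sumFin f + sumFin g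
  sumFin-+ {zero}  f g = sym (+-identityʳ 0#)
  sumFin-+ {suc k} f g = trans (+-congˡ (sumFin-+ (f ∘ suc) (g ∘ suc)))
    (solve 4 (λ a b x y → (a :+ b) :+ (x :+ y) := (a :+ x) :+ (b :+ y)) refl _ _ _ _)

  sumFin-*ˡ : ∀ {k} a (f : Fin k → Carrier) → sumFin (λ i → a * f i) ≈ a * sumFin f
  sumFin-*ˡ {zero}  a f = sym (zeroʳ a)
  sumFin-*ˡ {suc k} a f = trans (+-congˡ (sumFin-*ˡ a (f ∘ suc))) (sym (distribˡ _ _ _))

  sumFin-neg : ∀ {k} (f : Fin k → Carrier) → sumFin (λ i → - f i) ≈ - sumFin f
  sumFin-neg {zero}  f = sym -0#≈0#
  sumFin-neg {suc k} f = trans (+-congˡ (sumFin-neg (f ∘ suc))) (-‿+-comm _ _)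

  sumFin-↑ : ∀ n m (f : Fin (n ℕ.+ m) → Carrier) →
    sumFin f ≈ sumFin (λ i → f (i ↑ˡ m)) + sumFin (λ k → f (n ↑ʳ k))
  sumFin-↑ zero    m f = sym (+-identityˡ _)
  sumFin-↑ (suc n) m f = trans (+-congˡ (sumFin-↑ n m (f ∘ suc))) (sym (+-assoc _ _ _))

  sumFin-indicator : ∀ {k} (p : Fin k → Bool) (a : Carrier) →
    sumFin (λ e → if p e then a else 0#) ≈ a * natK (sum (fromBool ∘ p))
  sumFin-indicator {zero}  p a = sym (zeroʳ a)
  sumFin-indicator {suc k} p a with p zero
  ... | true  = trans (+-congˡ (sumFin-indicator (p ∘ suc) a))
                      (sym (trans (distribˡ _ _ _) (+-congʳ (*-identityʳ a))))
  ... | false = trans (+-identityˡ _) (sumFin-indicator (p ∘ suc) a)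

module Determinants {c ℓ : Level} (K : CommutativeRing c ℓ) where
  open CommutativeRing K hiding (zero)
  open Matrices K
  open RingSolver K
  open FinSums K
  open RingProperties ring using (-0#≈0#; -‿distribʳ-*; -‿injective; +-inverseʳ-unique)
  open import Relation.Binary.Reasoning.Setoid setoid
  open import Data.Product using (_×_)

  sign : ∀ {k} → Fin k → Carrier
  sign j = pow (- 1#) (toℕ j)

  minor : ∀ {N} → Mat (suc N) → Fin (suc N) → Mat N
  minor M j r s = M (suc r) (punchIn j s)

  expansionTerm : ∀ {N} → Mat (suc N) → Fin (suc N) → Carrier
  expansionTerm M j = sign j * M zero j * det (minor M j)

  det-cong : ∀ {N} {M M' : Mat N} → (∀ r s → M r s ≈ M' r s) → det M ≈ det M'
  det-cong {zero}  eq = refl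
  det-cong {suc N} {M} {M'} eq = sumFin-cong {f = expansionTerm M} {g = expansionTerm M'}
    λ j → *-cong (*-congˡ (eq zero j)) (det-cong λ r s → eq (suc r) (punchIn j s))

  AgreeExcept : ∀ {N} → Fin N → Mat N → Mat N → Set ℓ
  AgreeExcept i M A = ∀ r → r ≢ i → ∀ s → M r s ≈ A r s

  minor-agreeExcept : ∀ {N} {i : Fin N} {M A : Mat (suc N)} →
    AgreeExcept (suc i) M A → ∀ j → AgreeExcept i (minor M j) (minor A j)
  minor-agreeExcept eq j r r≢i s = eq (suc r) (r≢i ∘ suc-injective) (punchIn j s)

  minor-agreeExcept₀ : ∀ {N} {M A : Mat (suc N)} → AgreeExcept zero M A →
    ∀ j r s → minor M j r s ≈ minor A j r s
  minor-agreeExcept₀ eq j r s = eq (suc r) (λ ()) (punchIn j s)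

  det-additive : ∀ {N} (i : Fin N) {M A B : Mat N} → AgreeExcept i M A → AgreeExcept i M B →
    (∀ s → M i s ≈ A i s + B i s) → det M ≈ det A + det B
  det-additive {suc N} zero {M} {A} {B} eqA eqB eqi =
    trans (sumFin-cong term) (sumFin-+ (expansionTerm A) (expansionTerm B))
    where
    term : ∀ j → expansionTerm M j ≈ expansionTerm A j + expansionTerm B j
    term j = begin
      sign j * M zero j * det (minor M j)
        ≈⟨ *-congʳ (trans (*-congˡ (eqi j)) (distribˡ _ _ _)) ⟩
      (sign j * A zero j + sign j * B zero j) * det (minor M j)
        ≈⟨ distribʳ _ _ _ ⟩
      sign j * A zero j * det (minor M j) + sign j * B zero j * det (minor M j)
        ≈⟨ +-cong (*-congˡ (det-cong (minor-agreeExcept₀ eqA j)))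
                  (*-congˡ (det-cong (minor-agreeExcept₀ eqB j))) ⟩
      sign j * A zero j * det (minor A j) + sign j * B zero j * det (minor B j) ∎
  det-additive {suc N} (suc i) {M} {A} {B} eqA eqB eqi =
    trans (sumFin-cong term) (sumFin-+ (expansionTerm A) (expansionTerm B))
    where
    term : ∀ j → expansionTerm M j ≈ expansionTerm A j + expansionTerm B j
    term j = begin
      sign j * M zero j * det (minor M j)
        ≈⟨ *-cong (*-congˡ (eqA zero (λ ()) j))
                  (det-additive i (minor-agreeExcept eqA j) (minor-agreeExcept eqB j)
                                  (λ s → eqi (punchIn j s))) ⟩
      sign j * A zero j * (det (minor A j) + det (minor B j))
        ≈⟨ distribˡ _ _ _ ⟩
      sign j * A zero j * det (minor A j) + sign j * A zero j * det (minor B j)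
        ≈⟨ +-congˡ (*-congʳ (*-congˡ (trans (sym (eqA zero (λ ()) j)) (eqB zero (λ ()) j)))) ⟩
      sign j * A zero j * det (minor A j) + sign j * B zero j * det (minor B j) ∎

  det-homogeneous : ∀ {N} (i : Fin N) (k : Carrier) {M A : Mat N} → AgreeExcept i M A →
    (∀ s → M i s ≈ k * A i s) → det M ≈ k * det A
  det-homogeneous {suc N} zero k {M} {A} eqA eqi =
    trans (sumFin-cong term) (sumFin-*ˡ k (expansionTerm A))
    where
    term : ∀ j → expansionTerm M j ≈ k * expansionTerm A j
    term j = trans (*-cong (*-congˡ (eqi j)) (det-cong (minor-agreeExcept₀ eqA j)))
      (solve 4 (λ s k a d → s :* (k :* a) :* d := k :* (s :* a :* d)) refl _ _ _ _)
  det-homogeneous {suc N} (suc i) k {M} {A} eqA eqi =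
    trans (sumFin-cong term) (sumFin-*ˡ k (expansionTerm A))
    where
    term : ∀ j → expansionTerm M j ≈ k * expansionTerm A j
    term j = trans (*-cong (*-congˡ (eqA zero (λ ()) j))
                           (det-homogeneous i k (minor-agreeExcept eqA j) (λ s → eqi (punchIn j s))))
      (solve 3 (λ x k d → x :* (k :* d) := k :* (x :* d)) refl _ _ _)

  Extensional : ∀ {N L} → ((Fin N → Fin L) → Carrier) → Set ℓ
  Extensional G = ∀ {f g} → (∀ t → f t ≡ g t) → G f ≈ G g

  -- Laplace expansion along two rows a and b, where G f stands for the determinant of the
  -- remaining rows restricted to the columns f; det M is expand₂ on its first two rows.
  -- Splitting off column 0 leaves a term that is again an expand₂, one size smaller.
  expand₂ : ∀ N (a b : Fin (suc (suc N)) → Carrier) →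
    ((Fin N → Fin (suc (suc N))) → Carrier) → Carrier
  expand₂ N a b G = sumFin λ j → sign j * a j *
    sumFin λ k → sign k * b (punchIn j k) * G (punchIn j ∘ punchIn k)

  module _ (N : ℕ) (G : (Fin N → Fin (suc (suc N))) → Carrier) where

    leading : (Fin (suc (suc N)) → Carrier) → Carrier
    leading x = sumFin λ k → sign k * x (suc k) * G (suc ∘ punchIn k)

    restInner : (Fin (suc (suc N)) → Carrier) → Fin (suc N) → Carrier
    restInner b j = sumFin λ k →
      sign (suc k) * b (suc (punchIn j k)) * G (punchIn (suc j) ∘ punchIn (suc k))

    rest : (a b : Fin (suc (suc N)) → Carrier) → Carrier
    rest a b = sumFin λ j → sign (suc j) * a (suc j) * restInner b j

    expand₂-split : ∀ a b → expand₂ N a b G ≈ a zero * leading b - b zero * leading a + rest a b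
    expand₂-split a b = begin
      1# * a zero * leading b
        + sumFin (λ j → sign (suc j) * a (suc j) * (1# * b zero * G₁ j + restInner b j))
        ≈⟨ +-congˡ (sumFin-cong λ j → solve 5
             (λ s x g b₀ r → (con -[1+ 0 ] :* s) :* x :* (con (+ 1) :* b₀ :* g :+ r)
                           := :- (b₀ :* (s :* x :* g)) :+ (con -[1+ 0 ] :* s) :* x :* r)
             refl (sign j) (a (suc j)) (G₁ j) (b zero) (restInner b j)) ⟩
      1# * a zero * leading b + sumFin (λ j → - (b zero * aTerm j) + restTerm j)
        ≈⟨ +-congˡ (trans (sumFin-+ (λ j → - (b zero * aTerm j)) restTerm)
                          (+-congʳ (trans (sumFin-neg (λ j → b zero * aTerm j))
                                          (-‿cong (sumFin-*ˡ (b zero) aTerm))))) ⟩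
      1# * a zero * leading b + (- (b zero * leading a) + rest a b)
        ≈⟨ solve 5 (λ a₀ Lb b₀ La R → con (+ 1) :* a₀ :* Lb :+ (:- (b₀ :* La) :+ R)
                                    := a₀ :* Lb :- b₀ :* La :+ R)
             refl (a zero) (leading b) (b zero) (leading a) (rest a b) ⟩
      a zero * leading b - b zero * leading a + rest a b ∎
      where
      G₁ : Fin (suc N) → Carrier
      G₁ j = G (suc ∘ punchIn j)
      aTerm restTerm : Fin (suc N) → Carrier
      aTerm j = sign j * a (suc j) * G₁ j
      restTerm j = sign (suc j) * a (suc j) * restInner b j

  rest-expand₂ : ∀ N a b G → Extensional G →
    rest (suc N) G a b ≈ expand₂ N (a ∘ suc) (b ∘ suc) (G ∘ Fin.lift 1)
  rest-expand₂ N a b G ext = sumFin-cong λ j → trans (*-congˡ (inner j))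
      (solve 3 (λ s x S → (con -[1+ 0 ] :* s) :* x :* (con -[1+ 0 ] :* S) := s :* x :* S)
         refl (sign j) (a (suc j)) (sumFin (term j)))
    where
    term : Fin (suc (suc N)) → Fin (suc N) → Carrier
    term j k = sign k * b (suc (punchIn j k)) * G (Fin.lift 1 (punchIn j ∘ punchIn k))
    inner : ∀ j → restInner (suc N) G b j ≈ - 1# * sumFin (term j)
    inner j = trans
      (sumFin-cong λ k → trans (*-congˡ (ext {f = punchIn (suc j) ∘ punchIn (suc k)}
                                                 λ { zero → ≡.refl ; (suc t) → ≡.refl }))
        (solve 3 (λ s x g → (con -[1+ 0 ] :* s) :* x :* g := con -[1+ 0 ] :* (s :* x :* g))
           refl (sign k) (b (suc (punchIn j k))) (G (Fin.lift 1 (punchIn j ∘ punchIn k)))))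
      (sumFin-*ˡ (- 1#) (term j))

  mutual
    expand₂-antisym : ∀ N a b G → Extensional G → expand₂ N a b G ≈ - expand₂ N b a G
    expand₂-antisym N a b G ext = begin
      expand₂ N a b G                               ≈⟨ expand₂-split N G a b ⟩
      a zero * L b - b zero * L a + rest N G a b    ≈⟨ +-congˡ (rest-antisym N a b G ext) ⟩
      a zero * L b - b zero * L a + - rest N G b a
        ≈⟨ solve 5 (λ a₀ Lb b₀ La R → a₀ :* Lb :- b₀ :* La :+ :- R := :- (b₀ :* La :- a₀ :* Lb :+ R))
             refl (a zero) (L b) (b zero) (L a) (rest N G b a) ⟩
      - (b zero * L a - a zero * L b + rest N G b a)  ≈⟨ -‿cong (expand₂-split N G b a) ⟨
      - expand₂ N b a G                             ∎
      where
      L : (Fin (suc (suc N)) → Carrier) → Carrier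
      L = leading N G

    rest-antisym : ∀ N a b G → Extensional G → rest N G a b ≈ - rest N G b a
    rest-antisym zero a b G ext =
      solve 2 (λ x y → x :* con (+ 0) :+ con (+ 0) := :- (y :* con (+ 0) :+ con (+ 0)))
        refl (sign {2} (suc zero) * a (suc zero)) (sign {2} (suc zero) * b (suc zero))
    rest-antisym (suc N) a b G ext = begin
      rest (suc N) G a b                                    ≈⟨ rest-expand₂ N a b G ext ⟩
      expand₂ N (a ∘ suc) (b ∘ suc) (G ∘ Fin.lift 1)
        ≈⟨ expand₂-antisym N (a ∘ suc) (b ∘ suc) (G ∘ Fin.lift 1) ext-lift ⟩
      - expand₂ N (b ∘ suc) (a ∘ suc) (G ∘ Fin.lift 1)      ≈⟨ -‿cong (rest-expand₂ N b a G ext) ⟨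
      - rest (suc N) G b a                                  ∎
      where
      ext-lift : Extensional (G ∘ Fin.lift 1)
      ext-lift eq = ext λ { zero → ≡.refl ; (suc t) → ≡.cong suc (eq t) }

  Swaps : ∀ {N} → Fin N → Fin N → Mat N → Mat N → Set ℓ
  Swaps i j M M' = (∀ s → M' i s ≈ M j s) × (∀ s → M' j s ≈ M i s)
                 × (∀ r → r ≢ i → r ≢ j → ∀ s → M' r s ≈ M r s)

  det-swap₀₁ : ∀ {N} {M M' : Mat (suc (suc N))} → Swaps zero (suc zero) M M' → det M' ≈ - det M
  det-swap₀₁ {N} {M} {M'} (eq₀ , eq₁ , eqr) = begin
    det M'                                  ≈⟨ det-cong M'≈M₁₀ ⟩
    expand₂ N (M (suc zero)) (M zero) lower ≈⟨ expand₂-antisym N (M (suc zero)) (M zero) lower ext ⟩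
    - det M                                 ∎
    where
    lower : (Fin N → Fin (suc (suc N))) → Carrier
    lower f = det λ r s → M (suc (suc r)) (f s)
    ext : Extensional lower
    ext eq = det-cong λ r s → reflexive (≡.cong (M (suc (suc r))) (eq s))
    M₁₀ : Mat (suc (suc N))
    M₁₀ zero          = M (suc zero)
    M₁₀ (suc zero)    = M zero
    M₁₀ (suc (suc r)) = M (suc (suc r))
    M'≈M₁₀ : ∀ r s → M' r s ≈ M₁₀ r s
    M'≈M₁₀ zero          = eq₀
    M'≈M₁₀ (suc zero)    = eq₁
    M'≈M₁₀ (suc (suc r)) = eqr (suc (suc r)) (λ ()) (λ ())

  minor-swaps : ∀ {N} {i j : Fin N} {M M' : Mat (suc N)} →
    Swaps (suc i) (suc j) M M' → ∀ c → Swaps i j (minor M c) (minor M' c)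
  minor-swaps (eqi , eqj , eqr) c =
    (λ s → eqi (punchIn c s)) , (λ s → eqj (punchIn c s)) ,
    (λ r r≢i r≢j s → eqr (suc r) (r≢i ∘ suc-injective) (r≢j ∘ suc-injective) (punchIn c s))

  setRow : ∀ {N} → Fin N → (Fin N → Carrier) → Mat N → Mat N
  setRow i u M r = if ⌊ r ≟ i ⌋ then u else M r

  setRow-same : ∀ {N} (i : Fin N) u M s → setRow i u M i s ≈ u s
  setRow-same i u M s with i ≟ i
  ... | yes _   = refl
  ... | no i≢i = ⊥-elim (i≢i ≡.refl)

  setRow-other : ∀ {N} {i r : Fin N} u M → r ≢ i → ∀ s → setRow i u M r s ≈ M r s
  setRow-other {i = i} {r} u M r≢i s with r ≟ i
  ... | yes r≡i = ⊥-elim (r≢i r≡i)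
  ... | no _    = refl

  setRow-agreeExcept : ∀ {N} (i : Fin N) u M → AgreeExcept i (setRow i u M) M
  setRow-agreeExcept i u M r = setRow-other u M

  agreeExcept-setRow : ∀ {N} {i : Fin N} {A M : Mat N} u → AgreeExcept i A M →
    AgreeExcept i A (setRow i u M)
  agreeExcept-setRow {M = M} u agree r r≢i s = trans (agree r r≢i s) (sym (setRow-other u M r≢i s))

  setRow-agreeExcept₂ : ∀ {N} (i : Fin N) u u′ M → AgreeExcept i (setRow i u M) (setRow i u′ M)
  setRow-agreeExcept₂ i u u′ M = agreeExcept-setRow u′ (setRow-agreeExcept i u M)

  setRow-preservesAgreeExcept : ∀ {N} (i : Fin N) u {j} {A B : Mat N} → AgreeExcept j A B →
    AgreeExcept j (setRow i u A) (setRow i u B)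
  setRow-preservesAgreeExcept i u {A = A} {B} eq r r≢j s with r ≟ i
  ... | yes _ = refl
  ... | no _  = eq r r≢j s

  agreeExcept-complete : ∀ {N} {i : Fin N} {A B} → AgreeExcept i A B →
    (∀ s → A i s ≈ B i s) → ∀ r s → A r s ≈ B r s
  agreeExcept-complete {i = i} eq eqi r s with r ≟ i
  ... | yes ≡.refl = eqi s
  ... | no r≢i     = eq r r≢i s

  module _ {N} (i j : Fin N) (u v : Fin N → Carrier) (M : Mat N) where

    setRow₂-fst : ∀ s → setRow i u (setRow j v M) i s ≈ u s
    setRow₂-fst = setRow-same i u (setRow j v M)

    setRow₂-snd : j ≢ i → ∀ s → setRow i u (setRow j v M) j s ≈ v s
    setRow₂-snd j≢i s = trans (setRow-other u (setRow j v M) j≢i s) (setRow-same j v M s)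

    setRow₂-other : ∀ {r} → r ≢ i → r ≢ j → ∀ s → setRow i u (setRow j v M) r s ≈ M r s
    setRow₂-other r≢i r≢j s = trans (setRow-other u (setRow j v M) r≢i s) (setRow-other v M r≢j s)

  swapRows : ∀ {N} → Fin N → Fin N → Mat N → Mat N
  swapRows i j M = setRow i (M j) (setRow j (M i) M)

  swapRows-swaps : ∀ {N} {i j : Fin N} (M : Mat N) → i ≢ j → Swaps i j M (swapRows i j M)
  swapRows-swaps {i = i} {j} M i≢j =
    setRow₂-fst i j (M j) (M i) M , setRow₂-snd i j (M j) (M i) M (i≢j ∘ ≡.sym) ,
    λ r r≢i r≢j → setRow₂-other i j (M j) (M i) M r≢i r≢j

  byRows : ∀ {N} {i j : Fin N} {A B : Mat N} → (∀ s → A i s ≈ B i s) → (∀ s → A j s ≈ B j s) →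
    (∀ r → r ≢ i → r ≢ j → ∀ s → A r s ≈ B r s) → ∀ r s → A r s ≈ B r s
  byRows {i = i} {j} eqi eqj eqr r s with r ≟ i | r ≟ j
  ... | yes ≡.refl | _          = eqi s
  ... | no _       | yes ≡.refl = eqj s
  ... | no r≢i     | no r≢j     = eqr r r≢i r≢j s

  VanishesOnEqualRows : ℕ → Set (c ⊔ ℓ)
  VanishesOnEqualRows N = ∀ (M : Mat N) i j → i ≢ j → (∀ s → M i s ≈ M j s) → det M ≈ 0#

  vanishing⇒swap : ∀ {N} → VanishesOnEqualRows N → ∀ {M M' : Mat N} i j → i ≢ j →
    Swaps i j M M' → det M' ≈ - det M
  vanishing⇒swap vanish {M} {M'} i j i≢j (eqi , eqj , eqr) =
    +-inverseʳ-unique (det M) (det M') (begin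
      det M + det M'
        ≈⟨ solve 2 (λ x y → x :+ y := (con (+ 0) :+ x) :+ (y :+ con (+ 0))) refl (det M) (det M') ⟩
      (0# + det M) + (det M' + 0#)
        ≈⟨ +-cong (+-cong (sym (equal a)) (det-cong M≈Pab)) (+-cong (det-cong M'≈Pba) (sym (equal b))) ⟩
      (det (P a a) + det (P a b)) + (det (P b a) + det (P b b))
        ≈⟨ +-cong (additiveⱼ a) (additiveⱼ b) ⟨
      det (P a w) + det (P b w)
        ≈⟨ additiveᵢ ⟨
      det (P w w)
        ≈⟨ equal w ⟩
      0# ∎)
    where
    a b w : Fin _ → Carrier
    a = M i
    b = M j
    w s = a s + b s
    P : (Fin _ → Carrier) → (Fin _ → Carrier) → Mat _
    P u v = setRow i u (setRow j v M)
    fst : ∀ u v s → P u v i s ≈ u s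
    fst u v = setRow₂-fst i j u v M
    snd : ∀ u v s → P u v j s ≈ v s
    snd u v = setRow₂-snd i j u v M (i≢j ∘ ≡.sym)
    other : ∀ u v {r} → r ≢ i → r ≢ j → ∀ s → P u v r s ≈ M r s
    other u v = setRow₂-other i j u v M
    equal : ∀ u → det (P u u) ≈ 0#
    equal u = vanish (P u u) i j i≢j λ s → trans (fst u u s) (sym (snd u u s))
    M≈Pab : ∀ r s → M r s ≈ P a b r s
    M≈Pab = byRows (sym ∘ fst a b) (sym ∘ snd a b) λ r r≢i r≢j s → sym (other a b r≢i r≢j s)
    M'≈Pba : ∀ r s → M' r s ≈ P b a r s
    M'≈Pba = byRows (λ s → trans (eqi s) (sym (fst b a s))) (λ s → trans (eqj s) (sym (snd b a s)))
      λ r r≢i r≢j s → trans (eqr r r≢i r≢j s) (sym (other b a r≢i r≢j s))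
    additiveᵢ : det (P w w) ≈ det (P a w) + det (P b w)
    additiveᵢ = det-additive i (setRow-agreeExcept₂ i w a (setRow j w M))
                               (setRow-agreeExcept₂ i w b (setRow j w M))
                               λ s → trans (fst w w s) (sym (+-cong (fst a w s) (fst b w s)))
    additiveⱼ : ∀ u → det (P u w) ≈ det (P u a) + det (P u b)
    additiveⱼ u = det-additive j (setRow-preservesAgreeExcept i u (setRow-agreeExcept₂ j w a M))
                                 (setRow-preservesAgreeExcept i u (setRow-agreeExcept₂ j w b M))
                                 λ s → trans (snd u w s) (sym (+-cong (snd u a s) (snd u b s)))

  det-blockLowerTriangular : ∀ n m (M : Mat (n ℕ.+ m)) → (∀ i k → M (i ↑ˡ m) (n ↑ʳ k) ≈ 0#) →
    det M ≈ det (λ i j → M (i ↑ˡ m) (j ↑ˡ m)) * det (λ k l → M (n ↑ʳ k) (n ↑ʳ l))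
  det-blockLowerTriangular zero    m M upper = sym (*-identityˡ _)
  det-blockLowerTriangular (suc n) m M upper = begin
    det M
      ≈⟨ sumFin-↑ (suc n) m (expansionTerm M) ⟩
    sumFin (λ j → expansionTerm M (j ↑ˡ m)) + sumFin (λ k → expansionTerm M (suc n ↑ʳ k))
      ≈⟨ +-cong (sumFin-cong {g = λ j → det BR * expansionTerm TL j} left)
                (sumFin-zero λ k →
                   trans (*-congʳ (trans (*-congˡ (upper zero k)) (zeroʳ _))) (zeroˡ _)) ⟩
    sumFin (λ j → det BR * expansionTerm TL j) + 0#
      ≈⟨ trans (+-identityʳ _) (sumFin-*ˡ (det BR) (expansionTerm TL)) ⟩
    det BR * det TL
      ≈⟨ *-comm _ _ ⟩
    det TL * det BR ∎
    where
    TL : Mat (suc n)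
    TL i j = M (i ↑ˡ m) (j ↑ˡ m)
    BR : Mat m
    BR k l = M (suc n ↑ʳ k) (suc n ↑ʳ l)
    left : ∀ j → expansionTerm M (j ↑ˡ m) ≈ det BR * expansionTerm TL j
    left j = begin
      sign (j ↑ˡ m) * M zero (j ↑ˡ m) * det (minor M (j ↑ˡ m))
        ≈⟨ *-cong (*-congʳ (reflexive (≡.cong (pow (- 1#)) (toℕ-↑ˡ j m))))
                  (det-blockLowerTriangular n m (minor M (j ↑ˡ m)) λ i k →
                     trans (reflexive (≡.cong (M (suc i ↑ˡ m)) (punchIn-↑ʳ j k))) (upper (suc i) k)) ⟩
      sign j * TL zero j * (det (λ r s → M (suc r ↑ˡ m) (punchIn (j ↑ˡ m) (s ↑ˡ m)))
                            * det (λ r s → M (suc n ↑ʳ r) (punchIn (j ↑ˡ m) (n ↑ʳ s))))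
        ≈⟨ *-congˡ (*-cong (det-cong λ r s → reflexive (≡.cong (M (suc r ↑ˡ m)) (punchIn-↑ˡ m j s)))
                           (det-cong λ r s → reflexive (≡.cong (M (suc n ↑ʳ r)) (punchIn-↑ʳ j s)))) ⟩
      sign j * TL zero j * (det (minor TL j) * det BR)
        ≈⟨ solve 3 (λ a d b → a :* (d :* b) := b :* (a :* d)) refl _ _ _ ⟩
      det BR * expansionTerm TL j ∎

  idM-diag : ∀ {N} (i : Fin N) → idM i i ≈ 1#
  idM-diag i with i ≟ i
  ... | yes _   = refl
  ... | no i≢i = ⊥-elim (i≢i ≡.refl)

  idM-≢ : ∀ {N} {i j : Fin N} → i ≢ j → idM i j ≈ 0#
  idM-≢ {i = i} {j} i≢j with i ≟ j
  ... | yes i≡j = ⊥-elim (i≢j i≡j)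
  ... | no _    = refl

  idM-injective : ∀ {N L} (f : Fin N → Fin L) → (∀ {i j} → f i ≡ f j → i ≡ j) →
    ∀ i j → idM (f i) (f j) ≈ idM i j
  idM-injective f injective i j with f i ≟ f j | i ≟ j
  ... | yes _   | yes _   = refl
  ... | no _    | no _    = refl
  ... | yes fij | no i≢j  = ⊥-elim (i≢j (injective fij))
  ... | no fi≢j | yes i≡j = ⊥-elim (fi≢j (≡.cong f i≡j))

  sumFin-idM : ∀ {N} (f : Fin N → Carrier) (l : Fin N) → sumFin (λ k → f k * idM k l) ≈ f l
  sumFin-idM {suc N} f zero = begin
    f zero * 1# + sumFin (λ k → f (suc k) * idM (suc k) zero)
      ≈⟨ +-cong (*-identityʳ _) (sumFin-zero {f = λ k → f (suc k) * idM (suc k) zero} λ k → zeroʳ _) ⟩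
    f zero + 0#  ≈⟨ +-identityʳ _ ⟩
    f zero ∎
  sumFin-idM {suc N} f (suc l) = begin
    f zero * 0# + sumFin (λ k → f (suc k) * idM {suc N} (suc k) (suc l))
      ≈⟨ +-cong (zeroʳ _) (sumFin-cong λ k → *-congˡ (idM-injective suc suc-injective k l)) ⟩
    0# + sumFin (λ k → f (suc k) * idM k l)
      ≈⟨ trans (+-identityˡ _) (sumFin-idM (f ∘ suc) l) ⟩
    f (suc l) ∎

  det-scalar : ∀ N (x : Carrier) → det {N} (λ i j → x * idM i j) ≈ pow x N
  det-scalar zero    x = refl
  det-scalar (suc N) x = begin
    expansionTerm xI zero + sumFin (λ j → expansionTerm xI (suc j))
                              ≈⟨ +-cong diagonal (sumFin-zero {f = expansionTerm xI ∘ suc} offDiagonal) ⟩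
    x * pow x N + 0#          ≈⟨ +-identityʳ _ ⟩
    x * pow x N               ∎
    where
    xI : Mat (suc N)
    xI i j = x * idM i j
    diagonal : expansionTerm xI zero ≈ x * pow x N
    diagonal = *-cong (trans (*-identityˡ _) (*-identityʳ x))
      (trans (det-cong {N} λ r s → *-congˡ (idM-injective suc suc-injective r s)) (det-scalar N x))
    offDiagonal : ∀ j → expansionTerm xI (suc j) ≈ 0#
    offDiagonal j = trans (*-congʳ (trans (*-congˡ (zeroʳ x)) (zeroʳ _))) (zeroˡ _)

  det-scale : ∀ {N} (k : Carrier) (A : Mat N) → det (λ i j → k * A i j) ≈ pow k N * det A
  det-scale {zero}  k A = sym (*-identityˡ _)
  det-scale {suc N} k A = trans
    (sumFin-cong {g = λ j → (k * pow k N) * expansionTerm A j} λ j →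
       trans (*-congˡ (det-scale k (minor A j)))
             (solve 5 (λ s k a p d → s :* (k :* a) :* (p :* d) := (k :* p) :* (s :* a :* d))
                refl (sign j) k (A zero j) (pow k N) (det (minor A j))))
    (sumFin-*ˡ (k * pow k N) (expansionTerm A))

  -- Antisymmetry only gives det M + det M ≈ 0 for a repeated row, hence the hypothesis;
  -- in the theorem it follows from isq 2 * isq 2 * 2 ≈ 1.
  module _ (2-torsionFree : ∀ x → x + x ≈ 0# → x ≈ 0#) where

    det-equalRows₀₁ : ∀ {N} (M : Mat (suc (suc N))) → (∀ s → M zero s ≈ M (suc zero) s) → det M ≈ 0#
    det-equalRows₀₁ M eq = 2-torsionFree (det M) (begin
      det M + det M    ≈⟨ +-congˡ (det-swap₀₁ {M = M} {M' = M} (eq , sym ∘ eq , λ _ _ _ _ → refl)) ⟩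
      det M + - det M  ≈⟨ -‿inverseʳ (det M) ⟩
      0#               ∎)

    -- For rows 0 and j+2: swapping rows 1 and j+2 negates every minor and makes rows 0, 1 equal.
    det-equalRows₀ : ∀ N → VanishesOnEqualRows N →
      ∀ (M : Mat (suc N)) j → (∀ s → M zero s ≈ M (suc j) s) → det M ≈ 0#
    det-equalRows₀ (suc N) vanish M zero    eq = det-equalRows₀₁ M eq
    det-equalRows₀ (suc N) vanish M (suc j) eq = -‿injective (begin
      - det M   ≈⟨ sumFin-neg (expansionTerm M) ⟨
      sumFin (λ c → - expansionTerm M c)
                ≈⟨ sumFin-cong {g = expansionTerm M₁} (λ c → trans (-‿distribʳ-* _ _)
                     (*-cong (*-congˡ (sym (row₀ c)))
                             (sym (vanishing⇒swap vanish zero (suc j) (λ ()) (minor-swaps swaps c))))) ⟩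
      det M₁    ≈⟨ det-equalRows₀₁ M₁ (λ s → trans (row₀ s) (trans (eq s) (sym (proj₁ swaps s)))) ⟩
      0#        ≈⟨ -0#≈0# ⟨
      - 0#      ∎)
      where
      M₁ : Mat (suc (suc N))
      M₁ = swapRows (suc zero) (suc (suc j)) M
      swaps : Swaps (suc zero) (suc (suc j)) M M₁
      swaps = swapRows-swaps M (λ ())
      row₀ : ∀ s → M₁ zero s ≈ M zero s
      row₀ = proj₂ (proj₂ swaps) zero (λ ()) (λ ())

    det-equalRows : ∀ N → VanishesOnEqualRows N
    det-equalRows (suc N) M zero    zero    0≢0 eq = ⊥-elim (0≢0 ≡.refl)
    det-equalRows (suc N) M zero    (suc j) _   eq = det-equalRows₀ N (det-equalRows N) M j eq
    det-equalRows (suc N) M (suc i) zero    _   eq = det-equalRows₀ N (det-equalRows N) M i (sym ∘ eq)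
    det-equalRows (suc N) M (suc i) (suc j) i≢j eq = sumFin-zero {f = expansionTerm M} λ c →
      trans (*-congˡ (det-equalRows N (minor M c) i j (i≢j ∘ ≡.cong suc) (λ s → eq (punchIn c s))))
            (zeroʳ _)

    det-addRow : ∀ {N} {i j : Fin N} {M M' : Mat N} (k : Carrier) → i ≢ j → AgreeExcept i M' M →
      (∀ s → M' i s ≈ M i s + k * M j s) → det M' ≈ det M
    det-addRow {N} {i} {j} {M} {M'} k i≢j agree eqi = begin
      det M'
        ≈⟨ det-additive i agree (agreeExcept-setRow kMⱼ agree) rowᵢ ⟩
      det M + det (setRow i kMⱼ M)
        ≈⟨ +-congˡ (det-homogeneous i k (setRow-agreeExcept₂ i kMⱼ (M j) M) scaled) ⟩
      det M + k * det (setRow i (M j) M)  ≈⟨ +-congˡ (*-congˡ repeated) ⟩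
      det M + k * 0#                      ≈⟨ trans (+-congˡ (zeroʳ k)) (+-identityʳ _) ⟩
      det M                               ∎
      where
      kMⱼ : Fin N → Carrier
      kMⱼ s = k * M j s
      rowᵢ : ∀ s → M' i s ≈ M i s + setRow i kMⱼ M i s
      rowᵢ s = trans (eqi s) (+-congˡ (sym (setRow-same i kMⱼ M s)))
      scaled : ∀ s → setRow i kMⱼ M i s ≈ k * setRow i (M j) M i s
      scaled s = trans (setRow-same i kMⱼ M s) (*-congˡ (sym (setRow-same i (M j) M s)))
      repeated : det (setRow i (M j) M) ≈ 0#
      repeated = det-equalRows N (setRow i (M j) M) i j i≢j λ s →
        trans (setRow-same i (M j) M s) (sym (setRow-other (M j) M (i≢j ∘ ≡.sym) s))

    det-addCombination : ∀ {N K} (i : Fin N) {M M' : Mat N} (σ : Fin K → Fin N)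
      (w : Fin K → Carrier) →
      (∀ k → σ k ≢ i) → AgreeExcept i M' M →
      (∀ s → M' i s ≈ M i s + sumFin (λ k → w k * M (σ k) s)) → det M' ≈ det M
    det-addCombination {K = zero}  i σ w σ≢i agree eqi =
      det-cong (agreeExcept-complete agree (λ s → trans (eqi s) (+-identityʳ _)))
    det-addCombination {K = suc K} i {M} {M'} σ w σ≢i agree eqi = begin
      det M'  ≈⟨ det-addRow (w zero) (σ≢i zero ∘ ≡.sym) (agreeExcept-setRow u agree) rowᵢ′ ⟩
      det M₁  ≈⟨ det-addCombination i (σ ∘ suc) (w ∘ suc) (σ≢i ∘ suc) (setRow-agreeExcept i u M) rowᵢ ⟩
      det M   ∎
      where
      u : Fin _ → Carrier
      u s = M i s + sumFin (λ k → w (suc k) * M (σ (suc k)) s)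
      M₁ : Mat _
      M₁ = setRow i u M
      rowᵢ : ∀ s → M₁ i s ≈ u s
      rowᵢ = setRow-same i u M
      rowσ₀ : ∀ s → M₁ (σ zero) s ≈ M (σ zero) s
      rowσ₀ = setRow-other u M (σ≢i zero)
      rowᵢ′ : ∀ s → M' i s ≈ M₁ i s + w zero * M₁ (σ zero) s
      rowᵢ′ s = trans (eqi s) (trans (solve 3 (λ x y z → x :+ (y :+ z) := x :+ z :+ y) refl _ _ _)
                                     (+-cong (sym (rowᵢ s)) (*-congˡ (sym (rowσ₀ s)))))

    det-reduceTop : ∀ n m (x : Carrier) (W : Fin n → Fin m → Carrier) {M M' : Mat (n ℕ.+ m)} →
      (∀ i s → M' (i ↑ˡ m) s ≈ x * M (i ↑ˡ m) s + sumFin (λ k → W i k * M (n ↑ʳ k) s)) →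
      (∀ k s → M' (n ↑ʳ k) s ≈ M (n ↑ʳ k) s) → det M' ≈ pow x n * det M
    det-reduceTop zero    m x W top bottom = trans (det-cong bottom) (sym (*-identityˡ _))
    det-reduceTop (suc n) m x W {M} {M'} top bottom = begin
      det M'
        ≈⟨ sumFin-cong {f = expansionTerm M'} (λ c → trans
             (*-congˡ (det-reduceTop n m x (W ∘ suc) {minor M c}
                        (λ i s → top (suc i) (punchIn c s)) (λ k s → bottom k (punchIn c s))))
             (solve 3 (λ a p d → a :* (p :* d) := p :* (a :* d)) refl _ _ _)) ⟩
      sumFin (λ c → pow x n * expansionTerm M₁ c)   ≈⟨ sumFin-*ˡ (pow x n) (expansionTerm M₁) ⟩
      pow x n * det M₁
        ≈⟨ *-congˡ (det-addCombination zero (λ k → suc (n ↑ʳ k)) (W zero) (λ k ())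
             (setRow-agreeExcept₂ zero (M' zero) (λ s → x * M zero s) M)
             (top zero)) ⟩
      pow x n * det (setRow zero (λ s → x * M zero s) M)
        ≈⟨ *-congˡ (det-homogeneous zero x (setRow-agreeExcept zero (λ s → x * M zero s) M) (λ s → refl)) ⟩
      pow x n * (x * det M)
        ≈⟨ solve 3 (λ p x d → p :* (x :* d) := x :* p :* d) refl _ _ _ ⟩
      x * pow x n * det M ∎
      where
      M₁ : Mat (suc n ℕ.+ m)
      M₁ = setRow zero (M' zero) M

    -- Scaling the upper rows by x and adding B times the lower rows clears the upper-right block.
    det-schur : ∀ n m (B : Fin n → Fin m → Carrier) (C : Fin m → Fin n → Carrier) (x : Carrier)
      (M : Mat (n ℕ.+ m)) →
      (∀ i j → M (i ↑ˡ m) (j ↑ˡ m) ≈ x * idM i j) → (∀ i k → M (i ↑ˡ m) (n ↑ʳ k) ≈ - B i k) →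
      (∀ k i → M (n ↑ʳ k) (i ↑ˡ m) ≈ - C k i) → (∀ k l → M (n ↑ʳ k) (n ↑ʳ l) ≈ x * idM k l) →
      pow x n * det M ≈ pow x m * det (λ i j → x * x * idM i j - sumFin (λ k → B i k * C k j))
    det-schur n m B C x M ul ur ll lr = begin
      pow x n * det M                      ≈⟨ det-reduceTop n m x B top bottom ⟨
      det R                                ≈⟨ det-blockLowerTriangular n m R upperZero ⟩
      det (λ i j → R (i ↑ˡ m) (j ↑ˡ m)) * det (λ k l → R (n ↑ʳ k) (n ↑ʳ l))
        ≈⟨ *-cong (det-cong schurBlock) (trans (det-cong λ k l → trans (bottom k (n ↑ʳ l)) (lr k l))
                                                (det-scalar m x)) ⟩
      det S * pow x m                      ≈⟨ *-comm _ _ ⟩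
      pow x m * det S                      ∎
      where
      S : Mat n
      S i j = x * x * idM i j - sumFin (λ k → B i k * C k j)
      reduced : Fin n → Fin (n ℕ.+ m) → Carrier
      reduced i s = x * M (i ↑ˡ m) s + sumFin (λ k → B i k * M (n ↑ʳ k) s)
      R : Mat (n ℕ.+ m)
      R = reduced ++ (λ k → M (n ↑ʳ k))
      top : ∀ i s → R (i ↑ˡ m) s ≈ reduced i s
      top i s = reflexive (≡.cong-app (lookup-++ˡ reduced _ i) s)
      bottom : ∀ k s → R (n ↑ʳ k) s ≈ M (n ↑ʳ k) s
      bottom k s = reflexive (≡.cong-app (lookup-++ʳ reduced (λ k → M (n ↑ʳ k)) k) s)
      upperZero : ∀ i l → R (i ↑ˡ m) (n ↑ʳ l) ≈ 0#
      upperZero i l = begin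
        R (i ↑ˡ m) (n ↑ʳ l)
          ≈⟨ trans (top i (n ↑ʳ l)) (+-cong (*-congˡ (ur i l)) (sumFin-cong λ k →
               trans (*-congˡ (lr k l)) (solve 3 (λ b x d → b :* (x :* d) := x :* b :* d) refl _ _ _))) ⟩
        x * - B i l + sumFin (λ k → x * B i k * idM k l)
          ≈⟨ +-congˡ (sumFin-idM (λ k → x * B i k) l) ⟩
        x * - B i l + x * B i l
          ≈⟨ solve 2 (λ x b → x :* :- b :+ x :* b := con (+ 0)) refl x (B i l) ⟩
        0# ∎
      schurBlock : ∀ i j → R (i ↑ˡ m) (j ↑ˡ m) ≈ S i j
      schurBlock i j = begin
        R (i ↑ˡ m) (j ↑ˡ m)
          ≈⟨ trans (top i (j ↑ˡ m)) (+-cong (*-congˡ (ul i j)) (sumFin-cong λ k →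
               trans (*-congˡ (ll k j)) (sym (-‿distribʳ-* _ _)))) ⟩
        x * (x * idM i j) + sumFin (λ k → - (B i k * C k j))
          ≈⟨ +-cong (sym (*-assoc _ _ _)) (sumFin-neg (λ k → B i k * C k j)) ⟩
        S i j ∎

sameEdge-trans : ∀ {n} {v w a b c d : Fin n} →
  SameEdge (v , w) (a , b) → SameEdge (v , w) (c , d) → SameEdge (a , b) (c , d)
sameEdge-trans (inj₁ (≡.refl , ≡.refl)) (inj₁ (≡.refl , ≡.refl)) = inj₁ (≡.refl , ≡.refl)
sameEdge-trans (inj₁ (≡.refl , ≡.refl)) (inj₂ (≡.refl , ≡.refl)) = inj₂ (≡.refl , ≡.refl)
sameEdge-trans (inj₂ (≡.refl , ≡.refl)) (inj₁ (≡.refl , ≡.refl)) = inj₂ (≡.refl , ≡.refl)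
sameEdge-trans (inj₂ (≡.refl , ≡.refl)) (inj₂ (≡.refl , ≡.refl)) = inj₁ (≡.refl , ≡.refl)

module Subdivision {n m : ℕ} (E : EdgeList n m) (simple : Simple E) where
  open Counting

  joins : Fin n → Fin m → Fin n → Bool
  joins v e w = (⌊ v ≟ proj₁ (E e) ⌋ ∧ ⌊ w ≟ proj₂ (E e) ⌋) ∨ (⌊ w ≟ proj₁ (E e) ⌋ ∧ ⌊ v ≟ proj₂ (E e) ⌋)

  incidence : Fin n → Fin m → Bool
  incidence v e = incident v (E e)

  private
    loopless : ∀ e → proj₁ (E e) ≢ proj₂ (E e)
    loopless = proj₁ simple

  joins-sameEdge : ∀ {v w e} → joins v e w ≡ true → SameEdge (v , w) (E e)
  joins-sameEdge {v} {w} {e} j with v ≟ proj₁ (E e) | w ≟ proj₂ (E e) | w ≟ proj₁ (E e) | v ≟ proj₂ (E e)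
  ... | yes p | yes q | _     | _     = inj₁ (p , q)
  ... | yes _ | no _  | yes p | yes q = inj₂ (q , p)
  ... | no _  | _     | yes p | yes q = inj₂ (q , p)
  ... | yes _ | no _  | yes _ | no _  with () ← j
  ... | yes _ | no _  | no _  | _     with () ← j
  ... | no _  | _     | yes _ | no _  with () ← j
  ... | no _  | _     | no _  | _     with () ← j

  edgesJoining : ∀ v w → sum (λ e → fromBool (joins v e w)) ≡ fromBool (adjG E v w)
  edgesJoining v w = count-atMostOne (λ e → joins v e w) λ je jf →
    proj₂ simple _ _ (sameEdge-trans (joins-sameEdge {v} {w} je) (joins-sameEdge {v} {w} jf))

  incidence-neighbours : ∀ v e → fromBool (incidence v e) ≡ sum (λ w → fromBool (joins v e w))
  incidence-neighbours v e with v ≟ proj₁ (E e) | v ≟ proj₂ (E e)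
  ... | yes p | yes q = ⊥-elim (loopless e (≡.trans (≡.sym p) q))
  ... | yes _ | no _  = ≡.sym (≡.trans (sum-cong-≗ λ w → ≡.cong fromBool
                          (≡.trans (≡.cong (⌊ w ≟ proj₂ (E e) ⌋ ∨_) (∧-zeroʳ ⌊ w ≟ proj₁ (E e) ⌋))
                                   (∨-identityʳ ⌊ w ≟ proj₂ (E e) ⌋)))
                          (count-≟ (proj₂ (E e))))
  ... | no _  | yes _ = ≡.sym (≡.trans (sum-cong-≗ λ w → ≡.cong fromBool (∧-identityʳ ⌊ w ≟ proj₁ (E e) ⌋))
                          (count-≟ (proj₁ (E e))))
  ... | no _  | no _  = ≡.sym (sum-zero λ w → ≡.cong fromBool (∧-zeroʳ ⌊ w ≟ proj₁ (E e) ⌋))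

  degree-incidences : ∀ v → sum (λ e → fromBool (incidence v e)) ≡ degree (adjG E) v
  degree-incidences v = begin
    sum (λ e → fromBool (incidence v e))               ≡⟨ sum-cong-≗ (incidence-neighbours v) ⟩
    sum (λ e → sum (λ w → fromBool (joins v e w)))     ≡⟨ ∑-comm (λ e w → fromBool (joins v e w)) ⟩
    sum (λ w → sum (λ e → fromBool (joins v e w)))     ≡⟨ sum-cong-≗ (edgesJoining v) ⟩
    sum (fromBool ∘ adjG E v)                          ≡⟨ countFin-sum (adjG E v) ⟨
    degree (adjG E) v                                  ∎
    where open ≡.≡-Reasoning

  commonIncidence : ∀ {v w} → v ≢ w → ∀ e → (incidence v e ∧ incidence w e) ≡ joins v e w
  commonIncidence {v} {w} v≢w e
    with v ≟ proj₁ (E e) | v ≟ proj₂ (E e) | w ≟ proj₁ (E e) | w ≟ proj₂ (E e)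
  ... | yes p | yes q | _     | _     = ⊥-elim (loopless e (≡.trans (≡.sym p) q))
  ... | yes p | _     | yes q | _     = ⊥-elim (v≢w (≡.trans p (≡.sym q)))
  ... | _     | yes p | _     | yes q = ⊥-elim (v≢w (≡.trans p (≡.sym q)))
  ... | yes _ | no _  | no _  | yes _ = ≡.refl
  ... | yes _ | no _  | no _  | no _  = ≡.refl
  ... | no _  | yes _ | yes _ | no _  = ≡.refl
  ... | no _  | yes _ | no _  | no _  = ≡.refl
  ... | no _  | no _  | yes _ | _     = ≡.refl
  ... | no _  | no _  | no _  | _     = ≡.refl

  adjG-irreflexive : ∀ v → adjG E v v ≡ false
  adjG-irreflexive v = anyFin-false _ notLoop
    where
    notLoop : ∀ e → joins v e v ≡ false
    notLoop e with v ≟ proj₁ (E e) | v ≟ proj₂ (E e)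
    ... | yes p | yes q = ⊥-elim (loopless e (≡.trans (≡.sym p) q))
    ... | yes _ | no _  = ≡.refl
    ... | no _  | _     = ≡.refl

  adjS-old-old : ∀ v w → adjS E (v ↑ˡ m) (w ↑ˡ m) ≡ false
  adjS-old-old v w rewrite splitAt-↑ˡ n v m | splitAt-↑ˡ n w m = ≡.refl

  adjS-old-new : ∀ v e → adjS E (v ↑ˡ m) (n ↑ʳ e) ≡ incidence v e
  adjS-old-new v e rewrite splitAt-↑ˡ n v m | splitAt-↑ʳ n m e = ≡.refl

  adjS-new-old : ∀ e v → adjS E (n ↑ʳ e) (v ↑ˡ m) ≡ incidence v e
  adjS-new-old e v rewrite splitAt-↑ˡ n v m | splitAt-↑ʳ n m e = ≡.refl

  adjS-new-new : ∀ e f → adjS E (n ↑ʳ e) (n ↑ʳ f) ≡ false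
  adjS-new-new e f rewrite splitAt-↑ʳ n m e | splitAt-↑ʳ n m f = ≡.refl

  degree-old : ∀ v → degree (adjS E) (v ↑ˡ m) ≡ degree (adjG E) v
  degree-old v = begin
    countFin (adjS E (v ↑ˡ m))                        ≡⟨ countFin-sum (adjS E (v ↑ˡ m)) ⟩
    sum (fromBool ∘ adjS E (v ↑ˡ m))                  ≡⟨ sum-↑ n m (fromBool ∘ adjS E (v ↑ˡ m)) ⟩
    sum (λ w → fromBool (adjS E (v ↑ˡ m) (w ↑ˡ m))) ℕ.+ sum (λ e → fromBool (adjS E (v ↑ˡ m) (n ↑ʳ e)))
      ≡⟨ ≡.cong₂ ℕ._+_ (sum-zero λ w → ≡.cong fromBool (adjS-old-old v w))
                       (sum-cong-≗ λ e → ≡.cong fromBool (adjS-old-new v e)) ⟩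
    sum (λ e → fromBool (incidence v e))              ≡⟨ degree-incidences v ⟩
    degree (adjG E) v                                 ∎
    where open ≡.≡-Reasoning

  degree-new : ∀ e → degree (adjS E) (n ↑ʳ e) ≡ 2
  degree-new e = begin
    countFin (adjS E (n ↑ʳ e))                        ≡⟨ countFin-sum (adjS E (n ↑ʳ e)) ⟩
    sum (fromBool ∘ adjS E (n ↑ʳ e))                  ≡⟨ sum-↑ n m (fromBool ∘ adjS E (n ↑ʳ e)) ⟩
    sum (λ w → fromBool (adjS E (n ↑ʳ e) (w ↑ˡ m))) ℕ.+ sum (λ f → fromBool (adjS E (n ↑ʳ e) (n ↑ʳ f)))
      ≡⟨ ≡.cong₂ ℕ._+_ (sum-cong-≗ λ w → ≡.trans (≡.cong fromBool (adjS-new-old e w)) (endpoints w))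
                       (sum-zero λ f → ≡.cong fromBool (adjS-new-new e f)) ⟩
    sum (λ w → fromBool ⌊ w ≟ a ⌋ ℕ.+ fromBool ⌊ w ≟ b ⌋) ℕ.+ 0
      ≡⟨ ≡.cong (ℕ._+ 0) (∑-distrib-+ (λ w → fromBool ⌊ w ≟ a ⌋) (λ w → fromBool ⌊ w ≟ b ⌋)) ⟩
    sum (λ w → fromBool ⌊ w ≟ a ⌋) ℕ.+ sum (λ w → fromBool ⌊ w ≟ b ⌋) ℕ.+ 0
      ≡⟨ ≡.cong (ℕ._+ 0) (≡.cong₂ ℕ._+_ (count-≟ a) (count-≟ b)) ⟩
    2                                                 ∎
    where
    open ≡.≡-Reasoning
    a b : Fin n
    a = proj₁ (E e)
    b = proj₂ (E e)
    endpoints : ∀ w → fromBool (incidence w e) ≡ fromBool ⌊ w ≟ a ⌋ ℕ.+ fromBool ⌊ w ≟ b ⌋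
    endpoints w with w ≟ a | w ≟ b
    ... | yes p | yes q = ⊥-elim (loopless e (≡.trans (≡.sym p) q))
    ... | yes _ | no _  = ≡.refl
    ... | no _  | yes _ = ≡.refl
    ... | no _  | no _  = ≡.refl

module RandićOfSubdivision {c ℓ : Level} (K : CommutativeRing c ℓ) where
  open CommutativeRing K hiding (zero)
  open Matrices K
  open RingSolver K
  open FinSums K
  open Determinants K
  open Counting
  open RingProperties ring using (-0#≈0#)
  open import Relation.Binary.Reasoning.Setoid setoid

  if-* : ∀ (b b′ : Bool) (u u′ : Carrier) →
    (if b then u else 0#) * (if b′ then u′ else 0#) ≈ (if b ∧ b′ then u * u′ else 0#)
  if-* true  true  u u′ = refl
  if-* true  false u u′ = zeroʳ u
  if-* false b′    u u′ = zeroˡ _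

  module Spectrum (isq : ℕ → Carrier) (invSqrt : IsInvSqrt isq)
                  {n m : ℕ} (E : EdgeList n m) (simple : Simple E) (noIsolated : NoIsolated E) where
    open Subdivision E simple

    deg : Fin n → ℕ
    deg = degree (adjG E)

    q : Fin n → Carrier
    q v = isq (deg v)

    R : Mat (n ℕ.+ m)
    R = randic isq (adjS E)

    B : Fin n → Fin m → Carrier
    B v e = R (v ↑ˡ m) (n ↑ʳ e)

    C : Fin m → Fin n → Carrier
    C e w = R (n ↑ʳ e) (w ↑ˡ m)

    B-incidence : ∀ v e → B v e ≡ (if incidence v e then q v * isq 2 else 0#)
    B-incidence v e rewrite adjS-old-new v e | degree-old v | degree-new e = ≡.refl

    C-incidence : ∀ e w → C e w ≡ (if incidence w e then isq 2 * q w else 0#)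
    C-incidence e w rewrite adjS-new-old e w | degree-old w | degree-new e = ≡.refl

    two-BC : ∀ v w → natK 2 * sumFin (λ e → B v e * C e w)
                       ≈ q v * q w * natK (sum (λ e → fromBool (incidence v e ∧ incidence w e)))
    two-BC v w = begin
      natK 2 * sumFin (λ e → B v e * C e w)
        ≈⟨ *-congˡ (sumFin-cong λ e → trans
             (*-cong (reflexive (B-incidence v e)) (reflexive (C-incidence e w)))
             (if-* (incidence v e) (incidence w e) _ _)) ⟩
      natK 2 * sumFin (λ e → if incidence v e ∧ incidence w e then q v * isq 2 * (isq 2 * q w) else 0#)
        ≈⟨ *-congˡ (sumFin-indicator (λ e → incidence v e ∧ incidence w e) _) ⟩
      natK 2 * (q v * isq 2 * (isq 2 * q w) * natK common)
        ≈⟨ solve 5 (λ t a s b k → t :* (a :* s :* (s :* b) :* k) := a :* b :* k :* (s :* s :* t))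
             refl (natK 2) (q v) (isq 2) (q w) (natK common) ⟩
      q v * q w * natK common * (isq 2 * isq 2 * natK 2)
        ≈⟨ trans (*-congˡ (invSqrt 1)) (*-identityʳ _) ⟩
      q v * q w * natK common ∎
      where
      common : ℕ
      common = sum (λ e → fromBool (incidence v e ∧ incidence w e))

    invSqrt-degree : ∀ v → q v * q v * natK (deg v) ≈ 1#
    invSqrt-degree v with deg v | noIsolated v
    ... | suc d | _ = invSqrt d

    BC-nsLap-diagonal : ∀ v → natK 2 * sumFin (λ e → B v e * C e v) ≈ nsLap isq (adjG E) v v
    BC-nsLap-diagonal v = begin
      natK 2 * sumFin (λ e → B v e * C e v)
        ≈⟨ two-BC v v ⟩
      q v * q v * natK (sum (λ e → fromBool (incidence v e ∧ incidence v e)))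
        ≡⟨ ≡.cong (λ k → q v * q v * natK k)
             (≡.trans (sum-cong-≗ λ e → ≡.cong fromBool (∧-idem (incidence v e))) (degree-incidences v)) ⟩
      q v * q v * natK (deg v)
        ≈⟨ invSqrt-degree v ⟩
      1#
        ≈⟨ trans (+-cong (idM-diag v) (reflexive (≡.cong (λ b → if b then q v * q v else 0#)
                                                         (adjG-irreflexive v))))
                 (+-identityʳ 1#) ⟨
      nsLap isq (adjG E) v v ∎

    BC-nsLap-offDiagonal : ∀ {v w} → v ≢ w →
      natK 2 * sumFin (λ e → B v e * C e w) ≈ nsLap isq (adjG E) v w
    BC-nsLap-offDiagonal {v} {w} v≢w = begin
      natK 2 * sumFin (λ e → B v e * C e w)
        ≈⟨ two-BC v w ⟩
      q v * q w * natK (sum (λ e → fromBool (incidence v e ∧ incidence w e)))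
        ≡⟨ ≡.cong (λ k → q v * q w * natK k)
             (≡.trans (sum-cong-≗ λ e → ≡.cong fromBool (commonIncidence v≢w e)) (edgesJoining v w)) ⟩
      q v * q w * natK (fromBool (adjG E v w))
        ≈⟨ edgeValue (adjG E v w) ⟩
      0# + (if adjG E v w then q v * q w else 0#)
        ≈⟨ +-congʳ (idM-≢ v≢w) ⟨
      nsLap isq (adjG E) v w ∎
      where
      edgeValue : ∀ b → q v * q w * natK (fromBool b) ≈ 0# + (if b then q v * q w else 0#)
      edgeValue true  = trans (trans (*-congˡ (+-identityʳ 1#)) (*-identityʳ _)) (sym (+-identityˡ _))
      edgeValue false = trans (zeroʳ _) (sym (+-identityˡ _))

    BC-nsLap : ∀ v w → natK 2 * sumFin (λ e → B v e * C e w) ≈ nsLap isq (adjG E) v w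
    BC-nsLap v w = byCases (v ≟ w)
      where
      byCases : Dec (v ≡ w) → natK 2 * sumFin (λ e → B v e * C e w) ≈ nsLap isq (adjG E) v w
      byCases (yes ≡.refl) = BC-nsLap-diagonal v
      byCases (no v≢w)     = BC-nsLap-offDiagonal v≢w

    2-torsionFree : ∀ y → y + y ≈ 0# → y ≈ 0#
    2-torsionFree y y+y≈0 = begin
      y                            ≈⟨ *-identityˡ y ⟨
      1# * y                       ≈⟨ *-congʳ (invSqrt 1) ⟨
      isq 2 * isq 2 * natK 2 * y
        ≈⟨ solve 2 (λ s y → s :* s :* (con (+ 1) :+ (con (+ 1) :+ con (+ 0))) :* y := s :* s :* (y :+ y))
             refl (isq 2) y ⟩
      isq 2 * isq 2 * (y + y)      ≈⟨ *-congˡ y+y≈0 ⟩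
      isq 2 * isq 2 * 0#           ≈⟨ zeroʳ _ ⟩
      0#                           ∎

    R-old-old : ∀ v w → R (v ↑ˡ m) (w ↑ˡ m) ≡ 0#
    R-old-old v w rewrite adjS-old-old v w = ≡.refl

    R-new-new : ∀ e f → R (n ↑ʳ e) (n ↑ʳ f) ≡ 0#
    R-new-new e f rewrite adjS-new-new e f = ≡.refl

    module _ (x : Carrier) where

      charMatrix : Mat (n ℕ.+ m)
      charMatrix i j = x * idM i j - R i j

      charMatrix-old-old : ∀ v w → charMatrix (v ↑ˡ m) (w ↑ˡ m) ≈ x * idM v w
      charMatrix-old-old v w = trans
        (+-cong (*-congˡ (idM-injective (_↑ˡ m) (λ {i} {j} → ↑ˡ-injective m i j) v w))
                (trans (-‿cong (reflexive (R-old-old v w))) -0#≈0#))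
        (+-identityʳ _)

      charMatrix-new-new : ∀ e f → charMatrix (n ↑ʳ e) (n ↑ʳ f) ≈ x * idM e f
      charMatrix-new-new e f = trans
        (+-cong (*-congˡ (idM-injective (n ↑ʳ_) (λ {i} {j} → ↑ʳ-injective n i j) e f))
                (trans (-‿cong (reflexive (R-new-new e f))) -0#≈0#))
        (+-identityʳ _)

      charMatrix-old-new : ∀ v e → charMatrix (v ↑ˡ m) (n ↑ʳ e) ≈ - B v e
      charMatrix-old-new v e =
        trans (+-congʳ (trans (*-congˡ (idM-≢ (↑ˡ≢↑ʳ v e))) (zeroʳ x))) (+-identityˡ _)

      charMatrix-new-old : ∀ e v → charMatrix (n ↑ʳ e) (v ↑ˡ m) ≈ - C e v
      charMatrix-new-old e v =
        trans (+-congʳ (trans (*-congˡ (idM-≢ (↑ˡ≢↑ʳ v e ∘ ≡.sym))) (zeroʳ x))) (+-identityˡ _)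

      schurComplement : Mat n
      schurComplement v w = x * x * idM v w - sumFin (λ e → B v e * C e w)

      charPoly-schurComplement : pow x n * charPoly R x ≈ pow x m * det schurComplement
      charPoly-schurComplement = det-schur 2-torsionFree n m B C x charMatrix
        charMatrix-old-old charMatrix-old-new charMatrix-new-old charMatrix-new-new

      twice-schurComplement : ∀ v w →
        natK 2 * schurComplement v w ≈ natK 2 * (x * x) * idM v w - nsLap isq (adjG E) v w
      twice-schurComplement v w = trans
        (solve 4 (λ t x d S → t :* (x :* x :* d :- S) := t :* (x :* x) :* d :- t :* S)
           refl (natK 2) x (idM v w) (sumFin (λ e → B v e * C e w)))
        (+-congˡ (-‿cong (BC-nsLap v w)))

mainTheorem1 : ∀ {c ℓ : Level} (K : CommutativeRing c ℓ) →
    let open CommutativeRing K in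
    let open Matrices K in
    (isq : ℕ → Carrier) → IsInvSqrt isq →
    (n m : ℕ) (E : EdgeList n m) → Simple E → NoIsolated E →
    (x : Carrier) →
    pow (natK 2) n * pow x n * charPoly (randic isq (adjS E)) x
      ≈ pow x m * charPoly (nsLap isq (adjG E)) (natK 2 * (x * x))
mainTheorem1 K isq invSqrt n m E simple noIsolated x = begin
  pow 2ᴷ n * pow x n * charPoly R x              ≈⟨ *-assoc _ _ _ ⟩
  pow 2ᴷ n * (pow x n * charPoly R x)            ≈⟨ *-congˡ (charPoly-schurComplement x) ⟩
  pow 2ᴷ n * (pow x m * det S)                   ≈⟨ x∙yz≈y∙xz _ _ _ ⟩
  pow x m * (pow 2ᴷ n * det S)                   ≈⟨ *-congˡ (det-scale 2ᴷ S) ⟨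
  pow x m * det (λ v w → 2ᴷ * S v w)             ≈⟨ *-congˡ (det-cong (twice-schurComplement x)) ⟩
  pow x m * charPoly (nsLap isq (adjG E)) (2ᴷ * (x * x)) ∎
  where
  open CommutativeRing K
  open Matrices K
  open Determinants K using (det-cong; det-scale)
  open RandićOfSubdivision K
  open RandićOfSubdivision.Spectrum K isq invSqrt E simple noIsolated
  open import Algebra.Properties.CommutativeSemigroup *-commutativeSemigroup using (x∙yz≈y∙xz)
  open import Relation.Binary.Reasoning.Setoid setoid
  2ᴷ : Carrier
  2ᴷ = natK 2
  S : Mat n
  S = schurComplement x
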